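{- Let $i$ be an agent. If $\vDash\neg U_i\phi$ for every formula $\phi$ of $\mathbf{LUT}$, then $\vDash\neg\bullet_i\phi$ for every formula $\phi$ of $\mathbf{LUT}$.
   Context: Let $\mathbf{P}$ be a countably infinite set of propositional variables and $\mathbf{I}$ a finite set of agents. The language $\mathbf{LUT}$ is given by $\phi::= p\mid\neg\phi\mid(\phi\land\phi)\mid K_i\phi\mid[\phi]\phi\mid U_i\phi$ ($p\in\mathbf{P}$, $i\in\mathbf{I}$); $\mathbf{EL}$ is the fragment without $[\cdot]$ and $U_i$. The abbreviation $\bullet_i\phi$ stands for $\phi\land\neg K_i\phi$. A model is $\mathcal{M}=\langle S,\{R_i\}_{i\in\mathbf{I}},V\rangle$ with $S\neq\emptyset$, each $R_i$ a reflexive relation on $S$, $V:\mathbf{P}\to2^S$. Truth: $p$ true at $s$ iff $s\in V(p)$; Boolean clauses as usual; $\mathcal{M},s\vDash K_i\phi$ iff $\phi$ holds at all $t$ with $sR_it$; $\mathcal{M},s\vDash[\psi]\phi$ iff ($\mathcal{M},s\vDash\psi$ implies $\mathcal{M}|_\psi,s\vDash\phi$), with $\mathcal{M}|_\psi$ the restriction of $\mathcal{M}$ to the states where $\psi$ is true; $\mathcal{M},s\vDash U_i\phi$ iff $\mathcal{M},s\vDash\phi$ and for all $\psi\in\mathbf{EL}$, $\mathcal{M},s\vDash[\psi]\neg K_i\phi$. $\vDash\phi$ means $\phi$ is true at every state of every model. -}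

module Defs where

open import Data.Nat using (ℕ)
open import Data.Fin using (Fin)
open import Data.Product using (Σ; _×_; _,_; proj₁)
open import Data.Empty using (⊥)
open import Relation.Nullary using (¬_)

Prop : Set
Prop = ℕ

data Form (n : ℕ) : Set where
  var  : Prop → Form n
  neg  : Form n → Form n
  _∧_  : Form n → Form n → Form n
  K    : Fin n → Form n → Form n
  [_]_ : Form n → Form n → Form n
  U    : Fin n → Form n → Form n

data ELForm (n : ℕ) : Set where
  var : Prop → ELForm n
  neg : ELForm n → ELForm n
  _∧_ : ELForm n → ELForm n → ELForm n
  K   : Fin n → ELForm n → ELForm n

● : ∀ {n} → Fin n → Form n → Form n
● i φ = φ ∧ neg (K i φ)

record Model (n : ℕ) : Set₁ where
  field
    S     : Set
    R     : Fin n → S → S → Set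
    Rrefl : ∀ i s → R i s s
    V     : Prop → S → Set
open Model public

restrict : ∀ {n} (M : Model n) → (S M → Set) → Model n
restrict M P = record
  { S     = Σ (S M) P
  ; R     = λ i s t → R M i (proj₁ s) (proj₁ t)
  ; Rrefl = λ i s → Rrefl M i (proj₁ s)
  ; V     = λ p s → V M p (proj₁ s)
  }

satEL : ∀ {n} (M : Model n) → S M → ELForm n → Set
satEL M s (var p) = V M p s
satEL M s (neg φ) = ¬ satEL M s φ
satEL M s (φ ∧ ψ) = satEL M s φ × satEL M s ψ
satEL M s (K i φ) = ∀ t → R M i s t → satEL M t φ

sat : ∀ {n : ℕ} (M : Model n) → S M → Form n → Set
sat {n} M s (var p)   = V M p s
sat {n} M s (neg φ)   = ¬ sat M s φ
sat {n} M s (φ ∧ ψ)   = sat M s φ × sat M s ψ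
sat {n} M s (K i φ)   = ∀ t → R M i s t → sat M t φ
sat {n} M s ([ ψ ] φ) = (h : sat M s ψ) → sat (restrict M (λ t → sat M t ψ)) (s , h) φ
-- M,s ⊨ Uᵢ φ  iff  M,s ⊨ φ  and for all ψ ∈ EL, M,s ⊨ [ψ] ¬ Kᵢ φ
-- (the clause [ψ]¬Kᵢφ is unfolded using the clauses for [·], ¬ and Kᵢ)
sat {n} M s (U i φ)   =
  sat M s φ ×
  ((ψ : ELForm n) → (h : satEL M s ψ) →
     ¬ (∀ t → R (restrict M (λ u → satEL M u ψ)) i (s , h) t →
              sat (restrict M (λ u → satEL M u ψ)) t φ))

Valid : ∀ {n} → Form n → Set₁
Valid {n} φ = (M : Model n) (s : S M) → sat M s φ

-- A Moore sentence •ᵢ φ can never be known by i: Kᵢ(φ ∧ ¬Kᵢφ) gives Kᵢφ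
-- directly, while by reflexivity it also gives ¬Kᵢφ. This holds in every
-- model, in particular after any announcement, so •ᵢ φ already implies
-- Uᵢ(•ᵢ φ); hence validity of ¬Uᵢ(•ᵢ φ) forces validity of ¬•ᵢ φ.
module Submission where

open import Defs
open import Data.Nat using (ℕ)
open import Data.Fin using (Fin)
open import Data.Product using (_,_; proj₁; proj₂)
open import Relation.Nullary using (¬_)

K●-unsatisfiable : ∀ {n} (M : Model n) (s : S M) (i : Fin n) (φ : Form n) →
  ¬ sat M s (K i (● i φ))
K●-unsatisfiable M s i φ k = proj₂ (k s (Rrefl M i s)) (λ t r → proj₁ (k t r))

●⇒U● : ∀ {n} (M : Model n) (s : S M) (i : Fin n) (φ : Form n) →
  sat M s (● i φ) → sat M s (U i (● i φ))
●⇒U● M s i φ h = h , λ ψ hψ →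
  K●-unsatisfiable (restrict M (λ u → satEL M u ψ)) (s , hψ) i φ

mainTheorem14 : {n : ℕ} (i : Fin n) →
    ((φ : Form n) → Valid (neg (U i φ))) →
    (φ : Form n) → Valid (neg (● i φ))
mainTheorem14 i ¬U-valid φ M s h = ¬U-valid (● i φ) M s (●⇒U● M s i φ h)
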